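{- For all integers $m\ge 0$ and $n\ge 0$, $\#U(m,n)=u(m,n)$.
   Context: A strongly unimodal sequence of weight $n$ is a sequence of positive integers $(a_1,\ldots,a_\ell)$ such that, for some $1\le k\le \ell$, $$a_1<\cdots<a_k>\cdots>a_\ell\ge 1,$$ and $\sum_i a_i=n$. Its rank is $\ell-2k+1$. $u(m,n)$ is the number of such sequences of weight $n$ and rank $m$. $m$-Durfee rectangle symbol of a partition $\lambda$. Set $\lambda_k=0$ for $k>\ell(\lambda)$. If $\ell(\lambda)\ge m+1$, let $$j=\max\{k:1\le k\le\ell(\lambda),\ \lambda_{k+m}\ge k\};$$ otherwise let $j=0$. Then $$\alpha=(\lambda_1-j,\ldots,\lambda_{m+j}-j)',$$ the conjugate of the partition formed by the positive entries, and $$\beta=(\lambda_{m+j+1},\ldots,\lambda_{\ell(\lambda)}).$$ This is written $\lambda=(\alpha,\beta)_{(m+j)\times j}$. By convention $\alpha_i=0$ for $i>\ell(\alpha)$ and $\beta_i=0$ for $i>\ell(\beta)$. $U(m,n)$ is the set of partitions $\lambda$ of $n$ whose $m$-Durfee rectangle symbol $(\alpha,\beta)_{(m+j)\times j}$ satisfies all of the following: (1) $\ell(\alpha)-\ell(\beta)\le -1$ if $m\ge 1$, and $\ell(\alpha)-\ell(\beta)\le 0$ if $m=0$; (2) $\alpha_1\le m+j-1$; (3) each of $1,2,\ldots,m-1$ appears as a part of $\alpha$. -}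

module Defs where

open import Data.Bool using (Bool; true; false; _∧_; _∨_; not; if_then_else_; T)
open import Data.Nat using (ℕ; zero; suc; _+_; _*_; _∸_; _≤ᵇ_; _<ᵇ_; _≡ᵇ_; _⊔_)
open import Data.List using (List; []; _∷_; length; take; drop; map; filter; foldr)
open import Data.Nat.ListAction using (sum)
open import Data.Bool.ListAction using (any; all)
open import Data.List.Base using (upTo)
open import Data.Integer as ℤ using (ℤ; +_)
open import Relation.Nullary.Decidable using (⌊_⌋)
open import Data.Product using (Σ; _×_)
open import Data.Nat.Properties using (_≤?_)

strictlyIncreasing : List ℕ → Bool
strictlyIncreasing []           = true
strictlyIncreasing (x ∷ [])     = true
strictlyIncreasing (x ∷ y ∷ xs) = (x <ᵇ y) ∧ strictlyIncreasing (y ∷ xs)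

strictlyDecreasing : List ℕ → Bool
strictlyDecreasing []           = true
strictlyDecreasing (x ∷ [])     = true
strictlyDecreasing (x ∷ y ∷ xs) = (y <ᵇ x) ∧ strictlyDecreasing (y ∷ xs)

weaklyDecreasing : List ℕ → Bool
weaklyDecreasing []           = true
weaklyDecreasing (x ∷ [])     = true
weaklyDecreasing (x ∷ y ∷ xs) = (y ≤ᵇ x) ∧ weaklyDecreasing (y ∷ xs)

allPositive : List ℕ → Bool
allPositive = all (1 ≤ᵇ_)

isSUSRank : ℕ → ℕ → List ℕ → ℕ → Bool
isSUSRank m n a k =
  (1 ≤ᵇ k) ∧ (k ≤ᵇ length a)
  ∧ strictlyIncreasing (take k a)
  ∧ strictlyDecreasing (drop (k ∸ 1) a)
  ∧ allPositive a
  ∧ (sum a ≡ᵇ n)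
  ∧ ⌊ ((+ length a) ℤ.- (+ (2 * k))) ℤ.+ (+ 1) ℤ.≟ (+ m) ⌋

-- The set of strongly unimodal sequences of weight n and rank m.
-- (The peak index k is uniquely determined by the sequence.)
SUS : ℕ → ℕ → Set
SUS m n = Σ (List ℕ) λ a → Σ ℕ λ k → T (isSUSRank m n a k)

isPartitionOf : ℕ → List ℕ → Bool
isPartitionOf n λs = weaklyDecreasing λs ∧ allPositive λs ∧ (sum λs ≡ᵇ n)

-- 1-based entry λ_k, with λ_k = 0 for k = 0 or k > ℓ(λ)
nth : List ℕ → ℕ → ℕ
nth []       _             = 0
nth (x ∷ xs) zero          = 0
nth (x ∷ xs) (suc zero)    = x
nth (x ∷ xs) (suc (suc k)) = nth xs (suc k)

maxSat : (ℕ → Bool) → ℕ → ℕ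
maxSat p zero    = 0
maxSat p (suc N) = if p (suc N) then suc N else maxSat p N

maximum : List ℕ → ℕ
maximum = foldr _⊔_ 0

-- conjugate of a partition given by a list of nonnegative entries
-- (zero entries are irrelevant): μ'_i = #{r : μ_r ≥ i}, 1 ≤ i ≤ max μ
conjugate : List ℕ → List ℕ
conjugate μ = map (λ i → length (filter (λ x → suc i ≤? x) μ)) (upTo (maximum μ))

-- m-Durfee rectangle symbol (α, β)_{(m+j)×j}

durfeeJ : ℕ → List ℕ → ℕ
durfeeJ m λs =
  if suc m ≤ᵇ length λs
  then maxSat (λ k → k ≤ᵇ nth λs (k + m)) (length λs)
  else 0

durfeeα : ℕ → List ℕ → List ℕ
durfeeα m λs = conjugate (map (λ i → nth λs (suc i) ∸ j) (upTo (m + j)))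
  where j = durfeeJ m λs

durfeeβ : ℕ → List ℕ → List ℕ
durfeeβ m λs = drop (m + durfeeJ m λs) λs

head0 : List ℕ → ℕ
head0 []      = 0
head0 (x ∷ _) = x

inU : ℕ → List ℕ → Bool
inU m λs = cond1 ∧ cond2 ∧ cond3
  where
  j = durfeeJ m λs
  α = durfeeα m λs
  β = durfeeβ m λs
  cond1 = if 1 ≤ᵇ m then suc (length α) ≤ᵇ length β else length α ≤ᵇ length β
  -- α₁ ≤ m + j - 1 (as integers)
  cond2 = suc (head0 α) ≤ᵇ m + j
  cond3 = all (λ i → any (λ a → a ≡ᵇ i) α) (map suc (upTo (m ∸ 1)))

U : ℕ → ℕ → Set
U m n = Σ (List ℕ) λ λs → T (isPartitionOf n λs ∧ inU m λs)

{-# OPTIONS --safe #-}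
module Submission where

-- Cut λ ∈ U(m, n), whose m-Durfee rectangle is (m + j) × j, into its first m + j − 1 rows and
-- the partition β below the rectangle. By maximality of j, β has parts at most j, and condition (2)
-- says that row m + j has length exactly j. Subtracting the staircase (i − m)₊ from row i leaves a
-- sequence r of length m + j − 1 that is strictly decreasing: in the first m rows by condition (3),
-- further down because the staircase grows by one per row. Reading the multiplicities of j, j − 1,
-- …, 1 in β as the gaps of an increasing sequence gives f₁ < ⋯ < f_j with f_j = j + ℓ(β) and
-- Σ f = 1 + ⋯ + j + |β|, which is also what the staircase and row m + j weigh. Condition (1) is
-- exactly r₁ < f_j, so f ++ r is a strongly unimodal sequence of weight n with 2j + m − 1 parts and
-- peak at position j, i.e. of rank m.

open import Defs
open import Data.Nat using (ℕ)
open import Function.Bundles using (_↔_)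

open import Data.Bool using (Bool; true; false; T; T?; _∧_; if_then_else_)
open import Data.Bool.Properties using (T-∧; T-irrelevant)
open import Data.Bool.ListAction using (any; all)
open import Data.Empty using (⊥-elim)
open import Data.List using (List; []; _∷_; _++_; length; take; drop; map; filter; replicate; applyUpTo; upTo)
open import Data.List.Properties
  using (length-++; length-applyUpTo; length-drop; length-take; length-replicate;
         applyUpTo-∷ʳ; map-upTo; take++drop≡id; take-all; filter-accept; filter-reject)
open import Data.List.Relation.Unary.All as All using (All; []; _∷_)
open import Data.List.Relation.Unary.Any using (Any)
import Data.List.Relation.Unary.All.Properties as All
import Data.List.Relation.Unary.Any.Properties as Any
open import Data.Nat using (zero; suc; pred; _+_; _*_; _∸_; _≤_; _<_; _≥_; _>_; z≤n; s≤s; _≤ᵇ_; _<ᵇ_; _≡ᵇ_)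
open import Data.Nat.Properties
open import Data.Nat.ListAction using (sum)
open import Data.Nat.ListAction.Properties using (sum-++)
open import Data.Product using (∃; _×_; _,_; proj₁; proj₂)
open import Data.Sum using (inj₁; inj₂)
open import Function using (id; _∘_; _⇔_; mk⇔; Equivalence)
open import Function.Bundles using (mk↔ₛ′)
open import Relation.Binary.PropositionalEquality
open import Relation.Nullary using (¬_; yes; no)
open import Data.Nat.Solver using (module +-*-Solver)
import Data.Integer.Solver as ℤ-Solver
import Data.Integer as ℤ
import Data.Integer.Properties as ℤ
open import Relation.Nullary.Decidable using (toWitness; fromWitness)

open Equivalence using (to; from)

-- λ_{i+1} in the paper is at λ i: entries are read from 0, and are 0 past the end.
at : List ℕ → ℕ → ℕ
at xs i = nth xs (suc i)

at-≥length : ∀ xs {i} → length xs ≤ i → at xs i ≡ 0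
at-≥length []       _               = refl
at-≥length (x ∷ xs) {suc i} (s≤s p) = at-≥length xs p

at-++ˡ : ∀ xs {ys i} → i < length xs → at (xs ++ ys) i ≡ at xs i
at-++ˡ (x ∷ xs) {i = zero}  _       = refl
at-++ˡ (x ∷ xs) {i = suc i} (s≤s p) = at-++ˡ xs p

at-++ʳ : ∀ xs {ys} i → at (xs ++ ys) (length xs + i) ≡ at ys i
at-++ʳ []       i = refl
at-++ʳ (x ∷ xs) i = at-++ʳ xs i

at-drop : ∀ n xs i → at (drop n xs) i ≡ at xs (n + i)
at-drop zero    xs       i = refl
at-drop (suc n) []       i = refl
at-drop (suc n) (x ∷ xs) i = at-drop n xs i

at-applyUpTo : ∀ g {n i} → i < n → at (applyUpTo g n) i ≡ g i
at-applyUpTo g {suc n} {zero}  _       = refl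
at-applyUpTo g {suc n} {suc i} (s≤s p) = at-applyUpTo (g ∘ suc) p

applyUpTo-cong : ∀ {f g : ℕ → ℕ} n → (∀ {i} → i < n → f i ≡ g i) → applyUpTo f n ≡ applyUpTo g n
applyUpTo-cong zero    h = refl
applyUpTo-cong (suc n) h = cong₂ _∷_ (h (s≤s z≤n)) (applyUpTo-cong n (h ∘ s≤s))

applyUpTo-at : ∀ xs {t} → t ≤ length xs → applyUpTo (at xs) t ≡ take t xs
applyUpTo-at xs       {zero}  _       = refl
applyUpTo-at (x ∷ xs) {suc t} (s≤s p) = cong (x ∷_) (applyUpTo-at xs p)

applyUpTo-at-length : ∀ xs → applyUpTo (at xs) (length xs) ≡ xs
applyUpTo-at-length xs = trans (applyUpTo-at xs ≤-refl) (take-all (length xs) xs ≤-refl)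

take-++-length : ∀ (xs : List ℕ) {ys n} → length xs ≡ n → take n (xs ++ ys) ≡ xs
take-++-length []       refl = refl
take-++-length (x ∷ xs) refl = cong (x ∷_) (take-++-length xs refl)

drop-++-length : ∀ (xs : List ℕ) {ys n} → length xs ≡ n → drop n (xs ++ ys) ≡ ys
drop-++-length []       refl = refl
drop-++-length (x ∷ xs) refl = drop-++-length xs refl

drop-++-last : ∀ (xs : List ℕ) {ys s} → length xs ≡ suc s → drop s (xs ++ ys) ≡ at xs s ∷ ys
drop-++-last (x ∷ [])     {s = zero}  refl = refl
drop-++-last (x ∷ y ∷ xs) {s = suc s} e    = drop-++-last (y ∷ xs) (suc-injective e)

at-All : ∀ {P : ℕ → Set} {xs i} → All P xs → i < length xs → P (at xs i)
at-All {i = zero}  (px ∷ _)   _       = px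
at-All {i = suc i} (_  ∷ pxs) (s≤s p) = at-All pxs p

record Chain (R : ℕ → ℕ → Set) (xs : List ℕ) : Set where
  constructor mkChain
  field link : ∀ i → suc i < length xs → R (at xs i) (at xs (suc i))
open Chain

Chain-head : ∀ {R x y xs} → Chain R (x ∷ y ∷ xs) → R x y
Chain-head c = link c 0 (s≤s (s≤s z≤n))

Chain-tail : ∀ {R x xs} → Chain R (x ∷ xs) → Chain R xs
Chain-tail c = mkChain λ i p → link c (suc i) (s≤s p)

Chain-cons : ∀ {R x xs} → (0 < length xs → R x (at xs 0)) → Chain R xs → Chain R (x ∷ xs)
Chain-cons {R} {x} {xs} h c = mkChain link′
  where
  link′ : ∀ i → suc i < suc (length xs) → R (at (x ∷ xs) i) (at (x ∷ xs) (suc i))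
  link′ zero    p       = h (≤-pred p)
  link′ (suc i) (s≤s p) = link c i p

Chain-map : ∀ {R S : ℕ → ℕ → Set} {xs} → (∀ {a b} → R a b → S a b) → Chain R xs → Chain S xs
Chain-map f c = mkChain λ i p → f (link c i p)

Chain-++ : ∀ {R} xs {ys} → Chain R xs → Chain R ys →
           (0 < length xs → 0 < length ys → R (at xs (pred (length xs))) (at ys 0)) → Chain R (xs ++ ys)
Chain-++ []           cx cy h = cy
Chain-++ (x ∷ [])     cx cy h = Chain-cons (h (s≤s z≤n)) cy
Chain-++ (x ∷ y ∷ xs) cx cy h =
  Chain-cons (λ _ → Chain-head cx) (Chain-++ (y ∷ xs) (Chain-tail cx) cy (λ _ → h (s≤s z≤n)))

Chain-applyUpTo : ∀ {R} g n → (∀ i → suc i < n → R (g i) (g (suc i))) → Chain R (applyUpTo g n)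
Chain-applyUpTo {R} g n h = mkChain λ i p →
  let p′ = subst (suc i <_) (length-applyUpTo g n) p in
  subst₂ R (sym (at-applyUpTo g (<-trans (n<1+n i) p′))) (sym (at-applyUpTo g p′)) (h i p′)

Chain-drop : ∀ {R} n xs → Chain R xs → Chain R (drop n xs)
Chain-drop zero    xs       c = c
Chain-drop (suc n) []       c = c
Chain-drop (suc n) (x ∷ xs) c = Chain-drop n xs (Chain-tail c)

chainᵇ : (ℕ → ℕ → Bool) → List ℕ → Bool
chainᵇ p []           = true
chainᵇ p (x ∷ [])     = true
chainᵇ p (x ∷ y ∷ xs) = p x y ∧ chainᵇ p (y ∷ xs)

T-chainᵇ : ∀ p xs → T (chainᵇ p xs) ⇔ Chain (λ a b → T (p a b)) xs
T-chainᵇ p xs = mk⇔ (to′ xs) (from′ xs)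
  where
  to′ : ∀ xs → T (chainᵇ p xs) → Chain (λ a b → T (p a b)) xs
  to′ []           _ = mkChain λ _ ()
  to′ (x ∷ [])     _ = mkChain λ { _ (s≤s ()) }
  to′ (x ∷ y ∷ xs) t = let pxy , rest = to T-∧ t in Chain-cons (λ _ → pxy) (to′ (y ∷ xs) rest)
  from′ : ∀ xs → Chain (λ a b → T (p a b)) xs → T (chainᵇ p xs)
  from′ []           _ = _
  from′ (x ∷ [])     _ = _
  from′ (x ∷ y ∷ xs) c = from T-∧ (Chain-head c , from′ (y ∷ xs) (Chain-tail c))

strictlyIncreasing≡chainᵇ : ∀ xs → strictlyIncreasing xs ≡ chainᵇ _<ᵇ_ xs
strictlyIncreasing≡chainᵇ []           = refl
strictlyIncreasing≡chainᵇ (x ∷ [])     = refl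
strictlyIncreasing≡chainᵇ (x ∷ y ∷ xs) = cong ((x <ᵇ y) ∧_) (strictlyIncreasing≡chainᵇ (y ∷ xs))

strictlyDecreasing≡chainᵇ : ∀ xs → strictlyDecreasing xs ≡ chainᵇ (λ a b → b <ᵇ a) xs
strictlyDecreasing≡chainᵇ []           = refl
strictlyDecreasing≡chainᵇ (x ∷ [])     = refl
strictlyDecreasing≡chainᵇ (x ∷ y ∷ xs) = cong ((y <ᵇ x) ∧_) (strictlyDecreasing≡chainᵇ (y ∷ xs))

weaklyDecreasing≡chainᵇ : ∀ xs → weaklyDecreasing xs ≡ chainᵇ (λ a b → b ≤ᵇ a) xs
weaklyDecreasing≡chainᵇ []           = refl
weaklyDecreasing≡chainᵇ (x ∷ [])     = refl
weaklyDecreasing≡chainᵇ (x ∷ y ∷ xs) = cong ((y ≤ᵇ x) ∧_) (weaklyDecreasing≡chainᵇ (y ∷ xs))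

T-strictlyIncreasing : ∀ xs → T (strictlyIncreasing xs) ⇔ Chain _<_ xs
T-strictlyIncreasing xs rewrite strictlyIncreasing≡chainᵇ xs = mk⇔
  (Chain-map (<ᵇ⇒< _ _) ∘ to (T-chainᵇ _ xs)) (from (T-chainᵇ _ xs) ∘ Chain-map <⇒<ᵇ)

T-strictlyDecreasing : ∀ xs → T (strictlyDecreasing xs) ⇔ Chain _>_ xs
T-strictlyDecreasing xs rewrite strictlyDecreasing≡chainᵇ xs = mk⇔
  (Chain-map (<ᵇ⇒< _ _) ∘ to (T-chainᵇ _ xs)) (from (T-chainᵇ _ xs) ∘ Chain-map <⇒<ᵇ)

T-weaklyDecreasing : ∀ xs → T (weaklyDecreasing xs) ⇔ Chain _≥_ xs
T-weaklyDecreasing xs rewrite weaklyDecreasing≡chainᵇ xs = mk⇔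
  (Chain-map (≤ᵇ⇒≤ _ _) ∘ to (T-chainᵇ _ xs)) (from (T-chainᵇ _ xs) ∘ Chain-map ≤⇒≤ᵇ)

T-allPositive : ∀ xs → T (allPositive xs) ⇔ All (1 ≤_) xs
T-allPositive xs = mk⇔
  (All.map (≤ᵇ⇒≤ 1 _) ∘ All.all⁺ (1 ≤ᵇ_) xs) (All.all⁻ (1 ≤ᵇ_) ∘ All.map ≤⇒≤ᵇ)

_⟨∧⟩_ : ∀ {a b} {A B : Set} → T a ⇔ A → T b ⇔ B → T (a ∧ b) ⇔ (A × B)
_⟨∧⟩_ {a} p q = mk⇔ (λ t → let x , y = to (T-∧ {a}) t in to p x , to q y)
                    (λ (x , y) → from T-∧ (from p x , from q y))
infixr 2 _⟨∧⟩_

T-≤ᵇ : ∀ m n → T (m ≤ᵇ n) ⇔ m ≤ n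
T-≤ᵇ m n = mk⇔ (≤ᵇ⇒≤ m n) ≤⇒≤ᵇ

T-≡ᵇ : ∀ m n → T (m ≡ᵇ n) ⇔ m ≡ n
T-≡ᵇ m n = mk⇔ (≡ᵇ⇒≡ m n) (≡⇒≡ᵇ m n)

-- Antitone sequences and their conjugates

Antitone : (ℕ → ℕ) → ℕ → Set
Antitone g n = ∀ i → suc i < n → g (suc i) ≤ g i

antitone : ∀ {g n} → Antitone g n → ∀ {i k} → i ≤ k → k < n → g k ≤ g i
antitone anti {k = zero}  z≤n _ = ≤-refl
antitone anti {i} {suc k} i≤k k<n with m≤n⇒m<n∨m≡n i≤k
... | inj₂ refl       = ≤-refl
... | inj₁ (s≤s i≤k′) = ≤-trans (anti k k<n) (antitone anti i≤k′ (<-trans (n<1+n k) k<n))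

at-antitone : ∀ {xs} → Chain _≥_ xs → ∀ {i k} → i ≤ k → at xs k ≤ at xs i
at-antitone {xs} c {i} {k} i≤k with k <? length xs
... | yes k<ℓ = antitone (link c) i≤k k<ℓ
... | no  k≮ℓ = subst (_≤ at xs i) (sym (at-≥length xs (≮⇒≥ k≮ℓ))) z≤n

Antitone-suc : ∀ {g n} → Antitone g (suc n) → Antitone (g ∘ suc) n
Antitone-suc anti i p = anti (suc i) (s≤s p)

count≥ : ℕ → List ℕ → ℕ
count≥ c μ = length (filter (c ≤?_) μ)

record Threshold (c : ℕ) (g : ℕ → ℕ) (n w : ℕ) : Set where
  field
    w≤n   : w ≤ n
    above : ∀ {i} → i < w → c ≤ g i
    below : ∀ {i} → w ≤ i → i < n → g i < c

count≥-applyUpTo : ∀ {c g n w} → Threshold c g n w → count≥ c (applyUpTo g n) ≡ w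
count≥-applyUpTo {n = zero} record { w≤n = z≤n } = refl
count≥-applyUpTo {c} {g} {suc n} {zero} th =
  trans (cong length (filter-reject (c ≤?_) (<⇒≱ (below z≤n (s≤s z≤n)))))
        (count≥-applyUpTo record { w≤n = z≤n ; above = λ () ; below = λ _ p → below z≤n (s≤s p) })
  where open Threshold th
count≥-applyUpTo {c} {g} {suc n} {suc w} th =
  trans (cong length (filter-accept (c ≤?_) (above (s≤s z≤n))))
        (cong suc (count≥-applyUpTo record
          { w≤n = ≤-pred w≤n ; above = above ∘ s≤s ; below = λ p q → below (s≤s p) (s≤s q) }))
  where open Threshold th

threshold-exists : ∀ c {g} n → Antitone g n → ∃ (Threshold c g n)
threshold-exists c zero    _    = 0 , record { w≤n = z≤n ; above = λ () ; below = λ _ () }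
threshold-exists c {g} (suc n) anti with c ≤? g 0
... | no c≰g0 = 0 , record
  { w≤n = z≤n ; above = λ () ; below = λ _ p → ≤-<-trans (antitone anti z≤n p) (≰⇒> c≰g0) }
... | yes c≤g0 with threshold-exists c n (Antitone-suc anti)
...   | w , th = suc w , record
  { w≤n   = s≤s w≤n
  ; above = λ { {zero} _ → c≤g0 ; {suc i} (s≤s p) → above p }
  ; below = λ { {suc i} (s≤s p) (s≤s q) → below p q } }
  where open Threshold th

threshold : ∀ c {g} n → Antitone g n → Threshold c g n (count≥ c (applyUpTo g n))
threshold c n anti with threshold-exists c n anti
... | w , th = subst (Threshold c _ n) (sym (count≥-applyUpTo th)) th

maximum-applyUpTo-≤ : ∀ g n {b} → (∀ {i} → i < n → g i ≤ b) → maximum (applyUpTo g n) ≤ b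
maximum-applyUpTo-≤ g zero    h = z≤n
maximum-applyUpTo-≤ g (suc n) h = ⊔-lub (h (s≤s z≤n)) (maximum-applyUpTo-≤ (g ∘ suc) n (h ∘ s≤s))

maximum-antitone : ∀ {g n} → Antitone g (suc n) → maximum (applyUpTo g (suc n)) ≡ g 0
maximum-antitone {g} {n} anti =
  m≥n⇒m⊔n≡m (maximum-applyUpTo-≤ (g ∘ suc) n λ p → antitone anti z≤n (s≤s p))

module ConjugateOfAntitone {g : ℕ → ℕ} {n : ℕ} (anti : Antitone g (suc n)) where

  μ : List ℕ
  μ = applyUpTo g (suc n)

  column : ℕ → ℕ
  column i = count≥ (suc i) μ

  conjugate-≡ : conjugate μ ≡ applyUpTo column (g 0)
  conjugate-≡ = trans (map-upTo column (maximum μ)) (cong (applyUpTo column) (maximum-antitone anti))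

  length-conjugate : length (conjugate μ) ≡ g 0
  length-conjugate = trans (cong length conjugate-≡) (length-applyUpTo column (g 0))

  head-conjugate : head0 (conjugate μ) ≡ count≥ 1 μ
  head-conjugate = trans (cong head0 conjugate-≡) (head-applyUpTo (g 0) refl)
    where
    head-applyUpTo : ∀ k → g 0 ≡ k → head0 (applyUpTo column k) ≡ count≥ 1 μ
    head-applyUpTo zero    g0≡0 = sym (count≥-applyUpTo {g = g} record
      { w≤n = z≤n ; above = λ () ; below = λ {i} _ p → s≤s (subst (g i ≤_) g0≡0 (antitone anti z≤n p)) })
    head-applyUpTo (suc k) _    = refl

  head-conjugate<⇔ : suc (head0 (conjugate μ)) ≤ suc n ⇔ g n ≡ 0
  head-conjugate<⇔ = mk⇔
    (λ lt → n<1⇒n≡0 (below (≤-pred (subst (λ h → suc h ≤ suc n) head-conjugate lt)) ≤-refl))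
    (λ gn≡0 → subst (λ h → suc h ≤ suc n) (sym head-conjugate) (w<1+n gn≡0))
    where
    open Threshold (threshold 1 (suc n) anti)
    w<1+n : g n ≡ 0 → count≥ 1 μ < suc n
    w<1+n gn≡0 with m≤n⇒m<n∨m≡n w≤n
    ... | inj₁ lt = lt
    ... | inj₂ eq = ⊥-elim (<⇒≱ (above (subst (n <_) (sym eq) ≤-refl)) (≤-reflexive gn≡0))

  -- column i = v + 1 means that exactly the first v + 1 of the g's exceed i; take i = g (v + 1).
  part-conjugate⇔ : ∀ {v} → suc v < suc n → T (any (_≡ᵇ suc v) (conjugate μ)) ⇔ g (suc v) < g v
  part-conjugate⇔ {v} sv<1+n = mk⇔ strict part
    where
    v<1+n : v < suc n
    v<1+n = <-trans (n<1+n v) sv<1+n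
    strict : T (any (_≡ᵇ suc v) (conjugate μ)) → g (suc v) < g v
    strict t with Any.applyUpTo⁻ column (subst (λ α → Any _ α) conjugate-≡ (Any.any⁻ _ _ t))
    ... | i , _ , col≡ = <-≤-trans (below (≤-reflexive e) sv<1+n) (above (subst (v <_) (sym e) ≤-refl))
      where
      open Threshold (threshold (suc i) (suc n) anti)
      e : column i ≡ suc v
      e = ≡ᵇ⇒≡ (column i) (suc v) col≡
    part : g (suc v) < g v → T (any (_≡ᵇ suc v) (conjugate μ))
    part lt = Any.any⁺ _ (subst (λ α → Any _ α) (sym conjugate-≡)
      (Any.applyUpTo⁺ column (≡⇒≡ᵇ _ _ col≡) (<-≤-trans lt (antitone anti z≤n v<1+n))))
      where
      col≡ : column (g (suc v)) ≡ suc v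
      col≡ = count≥-applyUpTo record
        { w≤n = <⇒≤ sv<1+n
        ; above = λ p → <-≤-trans lt (antitone anti (≤-pred p) v<1+n)
        ; below = λ p q → s≤s (antitone anti p q) }

-- The m-Durfee rectangle

if-T : ∀ {A : Set} {b} {x y : A} → T b → (if b then x else y) ≡ x
if-T {b = true} _ = refl

if-¬T : ∀ {A : Set} {b} {x y : A} → ¬ T b → (if b then x else y) ≡ y
if-¬T {b = false} _  = refl
if-¬T {b = true}  ¬t = ⊥-elim (¬t _)

record IsMaxSat (p : ℕ → Bool) (N r : ℕ) : Set where
  field
    positive : 1 ≤ r
    holds    : T (p r)
    maximal  : ∀ {k} → r < k → k ≤ N → ¬ T (p k)

maxSat-≡ : ∀ {p N r} → IsMaxSat p N r → r ≤ N → maxSat p N ≡ r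
maxSat-≡ {N = zero} ms r≤N = ⊥-elim (<⇒≱ (IsMaxSat.positive ms) r≤N)
maxSat-≡ {p} {suc N} ms r≤N with m≤n⇒m<n∨m≡n r≤N
... | inj₂ refl       = if-T (IsMaxSat.holds ms)
... | inj₁ (s≤s r≤N′) = trans (if-¬T (IsMaxSat.maximal ms (s≤s r≤N′) ≤-refl))
  (maxSat-≡ record { IsMaxSat ms ; maximal = λ r<k k≤N → IsMaxSat.maximal ms r<k (m≤n⇒m≤1+n k≤N) } r≤N′)

maxSat-isMaxSat : ∀ p N {k} → 1 ≤ k → k ≤ N → T (p k) → IsMaxSat p N (maxSat p N)
maxSat-isMaxSat p zero    1≤k k≤0 _ = ⊥-elim (<⇒≱ 1≤k k≤0)
maxSat-isMaxSat p (suc N) {k} 1≤k k≤N pk with T? (p (suc N))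
... | yes pN = subst (IsMaxSat p (suc N)) (sym (if-T pN))
  record { positive = s≤s z≤n ; holds = pN ; maximal = λ lt le → ⊥-elim (<⇒≱ lt le) }
... | no ¬pN with m≤n⇒m<n∨m≡n k≤N
...   | inj₂ refl       = ⊥-elim (¬pN pk)
...   | inj₁ (s≤s k≤N′) = subst (IsMaxSat p (suc N)) (sym (if-¬T ¬pN))
  record { IsMaxSat ms ; maximal = maximal′ }
  where
  ms : IsMaxSat p N (maxSat p N)
  ms = maxSat-isMaxSat p N 1≤k k≤N′ pk
  maximal′ : ∀ {k′} → maxSat p N < k′ → k′ ≤ suc N → ¬ T (p k′)
  maximal′ lt le with m≤n⇒m<n∨m≡n le
  ... | inj₂ refl      = ¬pN
  ... | inj₁ (s≤s le′) = IsMaxSat.maximal ms lt le′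

-- The (m + j) × j Durfee rectangle of λs for j = s + 1, with 0-based row indices.
record DurfeeRectangle (m : ℕ) (λs : List ℕ) (s : ℕ) : Set where
  field
    rows    : suc (m + s) ≤ length λs
    fits    : suc s ≤ at λs (m + s)
    maximal : at λs (suc (m + s)) ≤ suc s

durfeeJ-short : ∀ m λs → length λs ≤ m → durfeeJ m λs ≡ 0
durfeeJ-short m λs ℓ≤m = if-¬T λ t → <⇒≱ (≤ᵇ⇒≤ (suc m) (length λs) t) ℓ≤m

module _ (m : ℕ) {λs : List ℕ} where

  private
    fitsᵇ : ℕ → Bool
    fitsᵇ k = k ≤ᵇ nth λs (k + m)

  durfeeJ-≡ : ∀ {s} → Chain _≥_ λs → DurfeeRectangle m λs s → durfeeJ m λs ≡ suc s
  durfeeJ-≡ {s} dec rect = trans (if-T (≤⇒≤ᵇ (≤-trans (s≤s (m≤m+n m s)) rows)))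
    (maxSat-≡ record { positive = s≤s z≤n ; holds = ≤⇒≤ᵇ (subst (λ i → suc s ≤ at λs i) (+-comm m s) fits)
                     ; maximal = too-big }
              (≤-trans (s≤s (m≤n+m s m)) rows))
    where
    open DurfeeRectangle rect
    too-big : ∀ {k} → suc s < k → k ≤ length λs → ¬ T (fitsᵇ k)
    too-big {suc k} (s≤s s<k) _ t = <⇒≱ (≤-trans (≤ᵇ⇒≤ (suc k) _ t) (≤-trans (at-antitone dec below) maximal)) s<k
      where
      below : suc (m + s) ≤ k + m
      below = subst (_≤ k + m) (cong suc (+-comm s m)) (+-monoˡ-≤ m s<k)

  durfeeJ-rectangle : All (1 ≤_) λs → Chain _≥_ λs → suc m ≤ length λs →
                      ∃ λ s → durfeeJ m λs ≡ suc s × DurfeeRectangle m λs s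
  durfeeJ-rectangle pos dec m<ℓ = from-max (maxSat fitsᵇ (length λs)) refl
    (maxSat-isMaxSat fitsᵇ (length λs) (s≤s z≤n) (≤-trans (s≤s z≤n) m<ℓ) (≤⇒≤ᵇ (at-All pos m<ℓ)))
    where
    from-max : ∀ r → maxSat fitsᵇ (length λs) ≡ r → IsMaxSat fitsᵇ (length λs) r →
               ∃ λ s → durfeeJ m λs ≡ suc s × DurfeeRectangle m λs s
    from-max zero    _  record { positive = () }
    from-max (suc s) eq ms = s , trans (if-T (≤⇒≤ᵇ m<ℓ)) eq , record { rows = rows ; fits = fits ; maximal = maximal }
      where
      open IsMaxSat ms using (holds) renaming (maximal to beyond)
      fits : suc s ≤ at λs (m + s)
      fits = subst (λ i → suc s ≤ at λs i) (+-comm s m) (≤ᵇ⇒≤ (suc s) _ holds)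
      rows : suc (m + s) ≤ length λs
      rows with suc (m + s) ≤? length λs
      ... | yes p = p
      ... | no ¬p = ⊥-elim (<⇒≱ (≤-trans (s≤s z≤n) fits) (≤-reflexive (at-≥length λs (≤-pred (≰⇒> ¬p)))))
      maximal : at λs (suc (m + s)) ≤ suc s
      maximal with suc (suc s) ≤? length λs
      ... | yes p = subst (λ i → at λs (suc i) ≤ suc s) (+-comm s m)
                          (≤-pred (≰⇒> λ t → beyond ≤-refl p (≤⇒≤ᵇ t)))
      ... | no ¬p = subst (_≤ suc s) (sym (at-≥length λs (≤-trans (≤-pred (≰⇒> ¬p)) (s≤s (m≤n+m s m))))) z≤n

-- Membership in U(m, n)

LengthCondition : ℕ → ℕ → ℕ → Set
LengthCondition zero    a b = a ≤ b
LengthCondition (suc _) a b = a < b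

lengthConditionᵇ : ℕ → ℕ → ℕ → Bool
lengthConditionᵇ m a b = if 1 ≤ᵇ m then suc a ≤ᵇ b else a ≤ᵇ b

T-lengthCondition : ∀ m {a b} → T (lengthConditionᵇ m a b) ⇔ LengthCondition m a b
T-lengthCondition zero    = T-≤ᵇ _ _
T-lengthCondition (suc m) = T-≤ᵇ _ _

partsᵇ : ℕ → List ℕ → Bool
partsᵇ m α = all (λ i → any (λ a → a ≡ᵇ i) α) (map suc (upTo (m ∸ 1)))

T-parts : ∀ m α → T (partsᵇ m α) ⇔ (∀ {v} → suc v < m → T (any (_≡ᵇ suc v) α))
T-parts zero    α = mk⇔ (λ _ ()) (λ _ → _)
T-parts (suc m) α rewrite map-upTo suc m = mk⇔ every all-true
  where
  p : ℕ → Bool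
  p i = any (_≡ᵇ i) α
  every : T (all p (applyUpTo suc m)) → ∀ {v} → suc v < suc m → T (p (suc v))
  every t v<m = All.applyUpTo⁻ suc m (All.all⁺ p _ t) (≤-pred v<m)
  all-true : (∀ {v} → suc v < suc m → T (p (suc v))) → T (all p (applyUpTo suc m))
  all-true h = All.all⁻ p (All.applyUpTo⁺₁ suc m (h ∘ s≤s))

-- Conditions (1)–(3) on a symbol (α, β) whose rectangle has N = m + j rows.
SymbolConditions : (m N : ℕ) (α β : List ℕ) → Set
SymbolConditions m N α β =
  LengthCondition m (length α) (length β) × suc (head0 α) ≤ N × (∀ {v} → suc v < m → T (any (_≡ᵇ suc v) α))

T-symbolConditions : ∀ m N α β →
  T (lengthConditionᵇ m (length α) (length β) ∧ (suc (head0 α) ≤ᵇ N) ∧ partsᵇ m α) ⇔ SymbolConditions m N α β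
T-symbolConditions m N α β = T-lengthCondition m ⟨∧⟩ T-≤ᵇ (suc (head0 α)) N ⟨∧⟩ T-parts m α

-- The conditions on the m-Durfee symbol of λs computed with an arbitrary j, N standing for m + j.
SymbolConditionsAt : (m N : ℕ) → List ℕ → ℕ → Set
SymbolConditionsAt m N λs j = SymbolConditions m N (conjugate (applyUpTo (λ i → at λs i ∸ j) N)) (drop N λs)

inU-symbolAt : ∀ m λs → T (inU m λs) ⇔ SymbolConditionsAt m (m + durfeeJ m λs) λs (durfeeJ m λs)
inU-symbolAt m λs rewrite sym (map-upTo (λ i → at λs i ∸ durfeeJ m λs) (m + durfeeJ m λs)) =
  T-symbolConditions m (m + durfeeJ m λs) (conjugate (map (λ i → at λs i ∸ durfeeJ m λs) (upTo (m + durfeeJ m λs))))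
                     (drop (m + durfeeJ m λs) λs)

inU-symbolAt-suc : ∀ {m λs s} → durfeeJ m λs ≡ suc s → T (inU m λs) ⇔ SymbolConditionsAt m (suc (m + s)) λs (suc s)
inU-symbolAt-suc {m} {λs} {s} j≡ = subst (λ N → T (inU m λs) ⇔ SymbolConditionsAt m N λs (suc s)) (+-suc m s)
  (subst (λ j → T (inU m λs) ⇔ SymbolConditionsAt m (m + j) λs j) j≡ (inU-symbolAt m λs))

inU-short : ∀ m {λs} → length λs ≤ m → ¬ T (inU m λs)
inU-short m {λs} ℓ≤m t with to (inU-symbolAt m λs) t
... | c rewrite durfeeJ-short m λs ℓ≤m = short m ℓ≤m c
  where
  short : ∀ m → length λs ≤ m → ¬ SymbolConditionsAt m (m + 0) λs 0
  short zero    _   (_ , c₂ , _) = n≮0 c₂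
  short (suc m) ℓ≤m (c₁ , _ , _) = n≮0 (subst (ℓα <_) ℓβ≡0 c₁)
    where
    ℓα : ℕ
    ℓα = length (conjugate (applyUpTo (λ i → at λs i ∸ 0) (suc m + 0)))
    ℓβ≡0 : length (drop (suc m + 0) λs) ≡ 0
    ℓβ≡0 = trans (length-drop (suc m + 0) λs) (m≤n⇒m∸n≡0 (≤-trans ℓ≤m (m≤m+n (suc m) 0)))

-- Conditions (2), (3), (1) on the symbol of λs, read off λs itself when j = s + 1.
record UConditions (m : ℕ) (λs : List ℕ) (s : ℕ) : Set where
  field
    corner    : at λs (m + s) ≤ suc s
    topStrict : ∀ {v} → suc v < m → at λs (suc v) < at λs v
    lengths   : LengthCondition m (at λs 0 ∸ suc s) (length λs ∸ suc (m + s))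

module _ {m s : ℕ} {λs : List ℕ} (dec : Chain _≥_ λs) (fits : suc s ≤ at λs (m + s)) where

  private
    g : ℕ → ℕ
    g i = at λs i ∸ suc s

    anti : Antitone g (suc (m + s))
    anti i _ = ∸-monoˡ-≤ (suc s) (at-antitone dec (n≤1+n i))

    open ConjugateOfAntitone anti

    fits-top : ∀ {v} → v < m → suc s ≤ at λs v
    fits-top v<m = ≤-trans fits (at-antitone dec (≤-trans (<⇒≤ v<m) (m≤m+n m s)))

    strict⇔ : ∀ {v} → suc v < m → g (suc v) < g v ⇔ at λs (suc v) < at λs v
    strict⇔ sv<m = mk⇔ (λ lt → ≰⇒> λ le → <⇒≱ lt (∸-monoˡ-≤ (suc s) le))
                       (λ lt → ∸-monoˡ-< lt (fits-top sv<m))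

    sv<1+m+s : ∀ {v} → suc v < m → suc v < suc (m + s)
    sv<1+m+s sv<m = ≤-trans sv<m (≤-trans (m≤m+n m s) (n≤1+n _))

  symbol⇔UConditions : SymbolConditionsAt m (suc (m + s)) λs (suc s) ⇔ UConditions m λs s
  symbol⇔UConditions = mk⇔ uConditions symbolConditions
    where
    ℓβ≡ : length (drop (suc (m + s)) λs) ≡ length λs ∸ suc (m + s)
    ℓβ≡ = length-drop (suc (m + s)) λs
    uConditions : SymbolConditionsAt m (suc (m + s)) λs (suc s) → UConditions m λs s
    uConditions (c₁ , c₂ , c₃) = record
      { corner    = m∸n≡0⇒m≤n (to head-conjugate<⇔ c₂)
      ; topStrict = λ sv<m → to (strict⇔ sv<m) (to (part-conjugate⇔ (sv<1+m+s sv<m)) (c₃ sv<m))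
      ; lengths   = subst₂ (LengthCondition m) length-conjugate ℓβ≡ c₁ }
    symbolConditions : UConditions m λs s → SymbolConditionsAt m (suc (m + s)) λs (suc s)
    symbolConditions c =
        subst₂ (LengthCondition m) (sym length-conjugate) (sym ℓβ≡) lengths
      , from head-conjugate<⇔ (m≤n⇒m∸n≡0 corner)
      , λ sv<m → from (part-conjugate⇔ (sv<1+m+s sv<m)) (from (strict⇔ sv<m) (topStrict sv<m))
      where open UConditions c

record UShape (m : ℕ) (λs : List ℕ) (s : ℕ) : Set where
  field
    rectangle  : DurfeeRectangle m λs s
    conditions : UConditions m λs s
  open DurfeeRectangle rectangle public
  open UConditions conditions public

  corner≡ : at λs (m + s) ≡ suc s
  corner≡ = ≤-antisym corner fits

inU⇒UShape : ∀ {m λs} → Chain _≥_ λs → All (1 ≤_) λs → T (inU m λs) →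
             ∃ λ s → durfeeJ m λs ≡ suc s × UShape m λs s
inU⇒UShape {m} {λs} dec pos t with suc m ≤? length λs
... | no m≮ℓ = ⊥-elim (inU-short m (≤-pred (≰⇒> m≮ℓ)) t)
... | yes m<ℓ with durfeeJ-rectangle m pos dec m<ℓ
...   | s , j≡ , rect = s , j≡ , record
  { rectangle  = rect
  ; conditions = to (symbol⇔UConditions dec (DurfeeRectangle.fits rect)) (to (inU-symbolAt-suc j≡) t) }

UShape⇒inU : ∀ {m λs s} → Chain _≥_ λs → UShape m λs s → durfeeJ m λs ≡ suc s × T (inU m λs)
UShape⇒inU {m} {λs} {s} dec shape = j≡ , from (inU-symbolAt-suc j≡) (from (symbol⇔UConditions dec fits) conditions)
  where
  open UShape shape
  j≡ : durfeeJ m λs ≡ suc s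
  j≡ = durfeeJ-≡ m dec rectangle

-- Increasing sequences and partitions with bounded parts

data IncreasingFrom : ℕ → List ℕ → Set where
  []  : ∀ {p} → IncreasingFrom p []
  _∷_ : ∀ {p x xs} → p < x → IncreasingFrom x xs → IncreasingFrom p (x ∷ xs)

data PartsAtMost : ℕ → List ℕ → Set where
  []   : ∀ {b} → PartsAtMost b []
  cons : ∀ {b x xs} → 1 ≤ x → x ≤ b → PartsAtMost x xs → PartsAtMost b (x ∷ xs)

IncreasingFrom⇒Chain : ∀ {p f} → IncreasingFrom p f → Chain _<_ f × All (p <_) f
IncreasingFrom⇒Chain [] = mkChain (λ _ ()) , []
IncreasingFrom⇒Chain (p<x ∷ inc) =
  let chain , above = IncreasingFrom⇒Chain inc in
  Chain-cons (at-All above) chain , p<x ∷ All.map (<-trans p<x) above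

Chain⇒IncreasingFrom : ∀ {p} f → Chain _<_ f → (0 < length f → p < at f 0) → IncreasingFrom p f
Chain⇒IncreasingFrom []           _     _ = []
Chain⇒IncreasingFrom (x ∷ [])     _     h = h (s≤s z≤n) ∷ []
Chain⇒IncreasingFrom (x ∷ y ∷ xs) chain h =
  h (s≤s z≤n) ∷ Chain⇒IncreasingFrom (y ∷ xs) (Chain-tail chain) (λ _ → Chain-head chain)

PartsAtMost⇒Chain : ∀ {b β} → PartsAtMost b β → Chain _≥_ β × All (1 ≤_) β × at β 0 ≤ b
PartsAtMost⇒Chain [] = mkChain (λ _ ()) , [] , z≤n
PartsAtMost⇒Chain (cons 1≤x x≤b parts) =
  let chain , pos , head≤x = PartsAtMost⇒Chain parts in Chain-cons (λ _ → head≤x) chain , 1≤x ∷ pos , x≤b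

Chain⇒PartsAtMost : ∀ {b} β → Chain _≥_ β → All (1 ≤_) β → at β 0 ≤ b → PartsAtMost b β
Chain⇒PartsAtMost []           _     _            _ = []
Chain⇒PartsAtMost (x ∷ [])     _     (1≤x ∷ _)    h = cons 1≤x h []
Chain⇒PartsAtMost (x ∷ y ∷ xs) chain (1≤x ∷ pos) h =
  cons 1≤x h (Chain⇒PartsAtMost (y ∷ xs) (Chain-tail chain) pos (Chain-head chain))

PartsAtMost-weaken : ∀ {w b β} → w ≤ b → PartsAtMost w β → PartsAtMost b β
PartsAtMost-weaken w≤b []                   = []
PartsAtMost-weaken w≤b (cons 1≤x x≤w parts) = cons 1≤x (≤-trans x≤w w≤b) parts

PartsAtMost-replicate : ∀ c {w b β} → 1 ≤ w → w ≤ b → PartsAtMost w β → PartsAtMost b (replicate c w ++ β)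
PartsAtMost-replicate zero    1≤w w≤b parts = PartsAtMost-weaken w≤b parts
PartsAtMost-replicate (suc c) 1≤w w≤b parts = cons 1≤w w≤b (PartsAtMost-replicate c 1≤w ≤-refl parts)

PartsAtMost-zero : ∀ {β} → PartsAtMost 0 β → β ≡ []
PartsAtMost-zero []               = refl
PartsAtMost-zero (cons 1≤x x≤0 _) = ⊥-elim (<⇒≱ 1≤x x≤0)

leading : ℕ → List ℕ → ℕ
leading v []       = 0
leading v (y ∷ ys) = if y ≡ᵇ v then suc (leading v ys) else 0

dropLeading : ℕ → List ℕ → List ℕ
dropLeading v []       = []
dropLeading v (y ∷ ys) = if y ≡ᵇ v then dropLeading v ys else y ∷ ys

module _ (v : ℕ) where

  leading-≡ : ∀ ys → leading v (v ∷ ys) ≡ suc (leading v ys)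
  leading-≡ ys = if-T (≡⇒≡ᵇ v v refl)

  dropLeading-≡ : ∀ ys → dropLeading v (v ∷ ys) ≡ dropLeading v ys
  dropLeading-≡ ys = if-T (≡⇒≡ᵇ v v refl)

  leading-≢ : ∀ {y} ys → y ≢ v → leading v (y ∷ ys) ≡ 0
  leading-≢ {y} ys y≢v = if-¬T (y≢v ∘ ≡ᵇ⇒≡ y v)

  dropLeading-≢ : ∀ {y} ys → y ≢ v → dropLeading v (y ∷ ys) ≡ y ∷ ys
  dropLeading-≢ {y} ys y≢v = if-¬T (y≢v ∘ ≡ᵇ⇒≡ y v)

  replicate-leading : ∀ β → replicate (leading v β) v ++ dropLeading v β ≡ β
  replicate-leading []       = refl
  replicate-leading (y ∷ ys) with y ≟ v
  ... | yes refl rewrite leading-≡ ys | dropLeading-≡ ys = cong (y ∷_) (replicate-leading ys)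
  ... | no  y≢v  rewrite leading-≢ ys y≢v | dropLeading-≢ ys y≢v = refl

  leading-replicate : ∀ c β → leading v (replicate c v ++ β) ≡ c + leading v β
  leading-replicate zero    β = refl
  leading-replicate (suc c) β = trans (leading-≡ (replicate c v ++ β)) (cong suc (leading-replicate c β))

  dropLeading-replicate : ∀ c β → dropLeading v (replicate c v ++ β) ≡ dropLeading v β
  dropLeading-replicate zero    β = refl
  dropLeading-replicate (suc c) β = trans (dropLeading-≡ (replicate c v ++ β)) (dropLeading-replicate c β)

  length-leading : ∀ β → length β ≡ leading v β + length (dropLeading v β)
  length-leading β = trans (cong length (sym (replicate-leading β)))
    (trans (length-++ (replicate (leading v β) v)) (cong (_+ length (dropLeading v β)) (length-replicate (leading v β))))

  sum-leading : ∀ β → sum β ≡ leading v β * v + sum (dropLeading v β)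
  sum-leading β = trans (cong sum (sym (replicate-leading β)))
    (trans (sum-++ (replicate (leading v β) v) _) (cong (_+ sum (dropLeading v β)) (sum-replicate (leading v β))))
    where
    sum-replicate : ∀ c → sum (replicate c v) ≡ c * v
    sum-replicate zero    = refl
    sum-replicate (suc c) = cong (v +_) (sum-replicate c)

leading-PartsAtMost : ∀ v {β} → PartsAtMost v β → leading (suc v) β ≡ 0 × dropLeading (suc v) β ≡ β
leading-PartsAtMost v []                 = refl , refl
leading-PartsAtMost v (cons {x = x} {xs = xs} _ x≤v _) = leading-≢ (suc v) xs x≢ , dropLeading-≢ (suc v) xs x≢
  where
  x≢ : x ≢ suc v
  x≢ e = 1+n≰n (subst (_≤ v) e x≤v)

dropLeading-PartsAtMost : ∀ v {β} → PartsAtMost (suc v) β → PartsAtMost v (dropLeading (suc v) β)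
dropLeading-PartsAtMost v [] = []
dropLeading-PartsAtMost v (cons {x = y} {xs = ys} 1≤y y≤v parts) with y ≟ suc v
... | yes refl rewrite dropLeading-≡ y ys = dropLeading-PartsAtMost v parts
... | no  y≢v  rewrite dropLeading-≢ (suc v) ys y≢v = cons 1≤y (≤-pred (≤∧≢⇒< y≤v y≢v)) parts

triangle : ℕ → ℕ
triangle zero    = 0
triangle (suc n) = suc n + triangle n

-- For prev < f₁ < ⋯ < f_v: the partition with f₁ ∸ (prev + 1) parts equal to v,
-- f₂ ∸ (f₁ + 1) parts equal to v ∸ 1, and so on; ungap v prev inverts it.
gapPartition : ℕ → ℕ → List ℕ → List ℕ
gapPartition v prev []       = []
gapPartition v prev (x ∷ fs) = replicate (x ∸ suc prev) v ++ gapPartition (pred v) x fs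

ungap : ℕ → ℕ → List ℕ → List ℕ
ungap zero    prev β = []
ungap (suc v) prev β =
  suc (prev + leading (suc v) β) ∷ ungap v (suc (prev + leading (suc v) β)) (dropLeading (suc v) β)

gapPartition-PartsAtMost : ∀ v {prev fs} → length fs ≡ v → IncreasingFrom prev fs →
                           PartsAtMost v (gapPartition v prev fs)
gapPartition-PartsAtMost v       {fs = []}     _    _         = []
gapPartition-PartsAtMost (suc v) {fs = x ∷ fs} refl (_ ∷ inc) =
  PartsAtMost-replicate _ (s≤s z≤n) ≤-refl (PartsAtMost-weaken (n≤1+n v) (gapPartition-PartsAtMost v refl inc))

ungap-gapPartition : ∀ v {prev fs} → length fs ≡ v → IncreasingFrom prev fs → ungap v prev (gapPartition v prev fs) ≡ fs
ungap-gapPartition zero    {fs = []}             _    _              = refl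
ungap-gapPartition (suc v) {prev} {fs = x ∷ fs} refl (prev<x ∷ inc) = begin
  ungap (suc v) prev (replicate gap (suc v) ++ rest)
    ≡⟨ cong₂ (λ L R → suc (prev + L) ∷ ungap v (suc (prev + L)) R) leading≡ dropLeading≡ ⟩
  suc (prev + gap) ∷ ungap v (suc (prev + gap)) rest
    ≡⟨ cong (λ y → y ∷ ungap v y rest) (m+[n∸m]≡n prev<x) ⟩
  x ∷ ungap v x rest
    ≡⟨ cong (x ∷_) (ungap-gapPartition v refl inc) ⟩
  x ∷ fs ∎
  where
  open ≡-Reasoning
  gap : ℕ
  gap = x ∸ suc prev
  rest : List ℕ
  rest = gapPartition v x fs
  small : leading (suc v) rest ≡ 0 × dropLeading (suc v) rest ≡ rest
  small = leading-PartsAtMost v (gapPartition-PartsAtMost v refl inc)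
  leading≡ : leading (suc v) (replicate gap (suc v) ++ rest) ≡ gap
  leading≡ = trans (leading-replicate (suc v) gap rest) (trans (cong (gap +_) (proj₁ small)) (+-identityʳ gap))
  dropLeading≡ : dropLeading (suc v) (replicate gap (suc v) ++ rest) ≡ rest
  dropLeading≡ = trans (dropLeading-replicate (suc v) gap rest) (proj₂ small)

gapPartition-ungap : ∀ v prev {β} → PartsAtMost v β → gapPartition v prev (ungap v prev β) ≡ β
gapPartition-ungap zero    prev parts rewrite PartsAtMost-zero parts = refl
gapPartition-ungap (suc v) prev {β} parts =
  trans (cong₂ _++_ (cong (λ c → replicate c (suc v)) (m+n∸m≡n (suc prev) (leading (suc v) β)))
                    (gapPartition-ungap v _ (dropLeading-PartsAtMost v parts)))
        (replicate-leading (suc v) β)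

length-ungap : ∀ v prev β → length (ungap v prev β) ≡ v
length-ungap zero    prev β = refl
length-ungap (suc v) prev β = cong suc (length-ungap v _ _)

ungap-increasing : ∀ v prev β → IncreasingFrom prev (ungap v prev β)
ungap-increasing zero    prev β = []
ungap-increasing (suc v) prev β = s≤s (m≤m+n prev _) ∷ ungap-increasing v _ _

sum-ungap : ∀ v prev {β} → PartsAtMost v β → sum (ungap v prev β) ≡ v * prev + triangle v + sum β
sum-ungap zero    prev parts rewrite PartsAtMost-zero parts = refl
sum-ungap (suc v) prev {β} parts = begin
  suc (prev + L) + sum (ungap v (suc (prev + L)) R)
    ≡⟨ cong (suc (prev + L) +_) (sum-ungap v (suc (prev + L)) (dropLeading-PartsAtMost v parts)) ⟩
  suc (prev + L) + (v * suc (prev + L) + triangle v + sum R)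
    ≡⟨ rearrange prev L v (triangle v) (sum R) ⟩
  suc v * prev + triangle (suc v) + (L * suc v + sum R)
    ≡⟨ cong (suc v * prev + triangle (suc v) +_) (sym (sum-leading (suc v) β)) ⟩
  suc v * prev + triangle (suc v) + sum β ∎
  where
  open ≡-Reasoning
  L : ℕ
  L = leading (suc v) β
  R : List ℕ
  R = dropLeading (suc v) β
  open +-*-Solver
  rearrange : ∀ p L v t r → suc (p + L) + (v * suc (p + L) + t + r) ≡ suc v * p + (suc v + t) + (L * suc v + r)
  rearrange = solve 5 (λ p L v t r → (con 1 :+ (p :+ L)) :+ (v :* (con 1 :+ (p :+ L)) :+ t :+ r)
                                  := (con 1 :+ v) :* p :+ ((con 1 :+ v) :+ t) :+ (L :* (con 1 :+ v) :+ r)) refl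

last-ungap : ∀ v prev {β} → PartsAtMost (suc v) β → at (ungap (suc v) prev β) v ≡ prev + suc v + length β
last-ungap zero prev {β} parts = begin
  suc (prev + L)          ≡⟨ cong (λ n → suc (prev + n)) L≡ℓ ⟩
  suc (prev + length β)   ≡⟨ sym (trans (+-assoc prev 1 (length β)) (+-suc prev (length β))) ⟩
  prev + 1 + length β     ∎
  where
  open ≡-Reasoning
  L : ℕ
  L = leading 1 β
  L≡ℓ : L ≡ length β
  L≡ℓ = sym (trans (length-leading 1 β) (trans
          (cong (λ R → L + length R) (PartsAtMost-zero (dropLeading-PartsAtMost 0 parts))) (+-identityʳ L)))
last-ungap (suc v) prev {β} parts = begin
  at (ungap (suc v) (suc (prev + L)) R) v         ≡⟨ last-ungap v (suc (prev + L)) (dropLeading-PartsAtMost (suc v) parts) ⟩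
  suc (prev + L) + suc v + length R               ≡⟨ rearrange prev L v (length R) ⟩
  prev + suc (suc v) + (L + length R)             ≡⟨ cong (prev + suc (suc v) +_) (sym (length-leading (suc (suc v)) β)) ⟩
  prev + suc (suc v) + length β ∎
  where
  open ≡-Reasoning
  L : ℕ
  L = leading (suc (suc v)) β
  R : List ℕ
  R = dropLeading (suc (suc v)) β
  open +-*-Solver
  rearrange : ∀ p L v r → suc (p + L) + suc v + r ≡ p + suc (suc v) + (L + r)
  rearrange = solve 4 (λ p L v r → (con 1 :+ (p :+ L)) :+ (con 1 :+ v) :+ r := p :+ (con 2 :+ v) :+ (L :+ r)) refl

-- Strongly unimodal sequences

rank⇔ : ∀ L K m → (ℤ.+ L ℤ.- ℤ.+ K) ℤ.+ ℤ.+ 1 ≡ ℤ.+ m ⇔ L + 1 ≡ m + K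
rank⇔ L K m = mk⇔
  (λ e → ℤ.+-injective (begin
    ℤ.+ (L + 1)                                 ≡⟨ ℤ.pos-+ L 1 ⟩
    ℤ.+ L ℤ.+ ℤ.+ 1                             ≡⟨ add-back (ℤ.+ L) (ℤ.+ K) ⟩
    (ℤ.+ L ℤ.- ℤ.+ K) ℤ.+ ℤ.+ 1 ℤ.+ ℤ.+ K       ≡⟨ cong (ℤ._+ ℤ.+ K) e ⟩
    ℤ.+ m ℤ.+ ℤ.+ K                             ≡⟨ ℤ.pos-+ m K ⟨
    ℤ.+ (m + K)                                 ∎))
  (λ e → begin
    (ℤ.+ L ℤ.- ℤ.+ K) ℤ.+ ℤ.+ 1                 ≡⟨ take-out (ℤ.+ L) (ℤ.+ K) ⟩
    ℤ.+ L ℤ.+ ℤ.+ 1 ℤ.- ℤ.+ K                   ≡⟨ cong (ℤ._- ℤ.+ K) (ℤ.pos-+ L 1) ⟨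
    ℤ.+ (L + 1) ℤ.- ℤ.+ K                       ≡⟨ cong (λ x → ℤ.+ x ℤ.- ℤ.+ K) e ⟩
    ℤ.+ (m + K) ℤ.- ℤ.+ K                       ≡⟨ cong (ℤ._- ℤ.+ K) (ℤ.pos-+ m K) ⟩
    ℤ.+ m ℤ.+ ℤ.+ K ℤ.- ℤ.+ K                   ≡⟨ cancel (ℤ.+ m) (ℤ.+ K) ⟩
    ℤ.+ m                                       ∎)
  where
  open ≡-Reasoning
  open ℤ-Solver.+-*-Solver
  add-back : ∀ a b → a ℤ.+ ℤ.+ 1 ≡ (a ℤ.- b) ℤ.+ ℤ.+ 1 ℤ.+ b
  add-back = solve 2 (λ a b → a :+ con (ℤ.+ 1) := (a :- b) :+ con (ℤ.+ 1) :+ b) refl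
  take-out : ∀ a b → (a ℤ.- b) ℤ.+ ℤ.+ 1 ≡ a ℤ.+ ℤ.+ 1 ℤ.- b
  take-out = solve 2 (λ a b → (a :- b) :+ con (ℤ.+ 1) := a :+ con (ℤ.+ 1) :- b) refl
  cancel : ∀ a b → a ℤ.+ b ℤ.- b ≡ a
  cancel = solve 2 (λ a b → a :+ b :- b := a) refl

T-isSUSRank : ∀ m n a k → T (isSUSRank m n a k) ⇔
  (1 ≤ k × k ≤ length a × Chain _<_ (take k a) × Chain _>_ (drop (k ∸ 1) a) × All (1 ≤_) a
   × sum a ≡ n × length a + 1 ≡ m + 2 * k)
T-isSUSRank m n a k =
  T-≤ᵇ 1 k ⟨∧⟩ T-≤ᵇ k (length a) ⟨∧⟩ T-strictlyIncreasing (take k a) ⟨∧⟩ T-strictlyDecreasing (drop (k ∸ 1) a)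
  ⟨∧⟩ T-allPositive a ⟨∧⟩ T-≡ᵇ (sum a) n ⟨∧⟩ mk⇔ (to rank ∘ toWitness) (fromWitness ∘ from rank)
  where
  rank : (ℤ.+ length a ℤ.- ℤ.+ (2 * k)) ℤ.+ ℤ.+ 1 ≡ ℤ.+ m ⇔ length a + 1 ≡ m + 2 * k
  rank = rank⇔ (length a) (2 * k) m

-- f ++ r with its peak at position s + 1, the last entry of f; length r ≡ m + s encodes rank m.
record UnimodalShape (m n s : ℕ) (f r : List ℕ) : Set where
  field
    length-f   : length f ≡ suc s
    length-r   : length r ≡ m + s
    increasing : IncreasingFrom 0 f
    decreasing : Chain _>_ r
    positive   : All (1 ≤_) r
    peak       : at r 0 < at f s
    weight     : sum f + sum r ≡ n

isSUSRank⇒UnimodalShape : ∀ {m n a k} → T (isSUSRank m n a k) →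
                          ∃ λ s → k ≡ suc s × UnimodalShape m n s (take k a) (drop k a)
isSUSRank⇒UnimodalShape {m} {n} {a} {suc s} t with to (T-isSUSRank m n a (suc s)) t
... | _ , k≤ℓ , inc , dec , pos , wt , rank = s , refl , record
  { length-f   = length-f
  ; length-r   = length-r
  ; increasing = Chain⇒IncreasingFrom f inc (at-All (All.take⁺ (suc s) pos))
  ; decreasing = Chain-tail peak-r
  ; positive   = All.drop⁺ (suc s) pos
  ; peak       = peak
  ; weight     = trans (sym (sum-++ f r)) (trans (cong sum (take++drop≡id (suc s) a)) wt) }
  where
  f : List ℕ
  f = take (suc s) a
  r : List ℕ
  r = drop (suc s) a
  length-f : length f ≡ suc s
  length-f = trans (length-take (suc s) a) (m≤n⇒m⊓n≡m k≤ℓ)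
  length-r : length r ≡ m + s
  length-r = +-cancelˡ-≡ (suc s) _ _ (+-cancelʳ-≡ 1 _ _ (begin
    suc s + length r + 1       ≡⟨ cong (λ ℓ → ℓ + length r + 1) length-f ⟨
    length f + length r + 1    ≡⟨ cong (_+ 1) (length-++ f) ⟨
    length (f ++ r) + 1        ≡⟨ cong (λ xs → length xs + 1) (take++drop≡id (suc s) a) ⟩
    length a + 1               ≡⟨ rank ⟩
    m + 2 * suc s              ≡⟨ rearrange m s ⟩
    suc s + (m + s) + 1        ∎))
    where
    open ≡-Reasoning
    open +-*-Solver
    rearrange : ∀ m s → m + 2 * suc s ≡ suc s + (m + s) + 1
    rearrange = solve 2 (λ m s → m :+ con 2 :* (con 1 :+ s) := (con 1 :+ s) :+ (m :+ s) :+ con 1) refl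
  peak-r : Chain _>_ (at f s ∷ r)
  peak-r = subst (Chain _>_) (trans (cong (drop s) (sym (take++drop≡id (suc s) a))) (drop-++-last f length-f)) dec
  peak : at r 0 < at f s
  peak with r | peak-r
  ... | []    | _     = at-All (All.take⁺ (suc s) pos) (≤-reflexive (sym length-f))
  ... | _ ∷ _ | chain = Chain-head chain

UnimodalShape⇒isSUSRank : ∀ {m n s f r} → UnimodalShape m n s f r → T (isSUSRank m n (f ++ r) (suc s))
UnimodalShape⇒isSUSRank {m} {n} {s} {f} {r} shape = from (T-isSUSRank m n (f ++ r) (suc s))
  ( s≤s z≤n
  , subst (suc s ≤_) (sym ℓ≡) (m≤m+n (suc s) (m + s))
  , subst (Chain _<_) (sym (take-++-length f length-f)) (proj₁ (IncreasingFrom⇒Chain increasing))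
  , subst (Chain _>_) (sym (drop-++-last f length-f)) (Chain-cons (λ _ → peak) decreasing)
  , All.++⁺ (proj₂ (IncreasingFrom⇒Chain increasing)) positive
  , trans (sum-++ f r) weight
  , trans (cong (_+ 1) ℓ≡) (rearrange m s) )
  where
  open UnimodalShape shape
  ℓ≡ : length (f ++ r) ≡ suc s + (m + s)
  ℓ≡ = trans (length-++ f) (cong₂ _+_ length-f length-r)
  open +-*-Solver
  rearrange : ∀ m s → suc s + (m + s) + 1 ≡ m + 2 * suc s
  rearrange = solve 2 (λ m s → (con 1 :+ s) :+ (m :+ s) :+ con 1 := m :+ con 2 :* (con 1 :+ s)) refl

-- The bijection

lengthCondition⇔ : ∀ m {s A b r} → A ≡ r + (1 ∸ m) → suc s ≤ A → LengthCondition m (A ∸ suc s) b ⇔ r < suc s + b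
lengthCondition⇔ zero {s} {A} {b} {r} A≡ s<A = mk⇔
  (λ d≤b → subst (_< suc s + b) (sym r≡) (s≤s (+-monoʳ-≤ s d≤b)))
  (λ r<  → +-cancelˡ-≤ s _ _ (≤-pred (subst (_< suc s + b) r≡ r<)))
  where
  r≡ : r ≡ s + (A ∸ suc s)
  r≡ = suc-injective (trans (+-comm 1 r) (trans (sym A≡) (sym (m+[n∸m]≡n s<A))))
lengthCondition⇔ (suc m) {s} {A} {b} {r} A≡ s<A = mk⇔
  (λ d<b → subst (_< suc s + b) (sym r≡) (+-monoʳ-< (suc s) d<b))
  (λ r<  → +-cancelˡ-< (suc s) _ _ (subst (_< suc s + b) r≡ r<))
  where
  r≡ : r ≡ suc s + (A ∸ suc s)
  r≡ = trans (sym (+-identityʳ r)) (trans (cong (r +_) (sym (0∸n≡0 m))) (trans (sym A≡) (sym (m+[n∸m]≡n s<A))))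

suc∸≤ : ∀ a m → suc a ∸ m ≤ suc (a ∸ m)
suc∸≤ a       zero    = ≤-refl
suc∸≤ zero    (suc m) = subst (_≤ 1) (sym (0∸n≡0 m)) z≤n
suc∸≤ (suc a) (suc m) = suc∸≤ a m

sum-applyUpTo-+ : ∀ (g h : ℕ → ℕ) n → sum (applyUpTo (λ i → g i + h i) n) ≡ sum (applyUpTo g n) + sum (applyUpTo h n)
sum-applyUpTo-+ g h zero    = refl
sum-applyUpTo-+ g h (suc n) =
  trans (cong (g 0 + h 0 +_) (sum-applyUpTo-+ (g ∘ suc) (h ∘ suc) n)) (+-+-swap (g 0) (h 0) _ _)
  where
  open +-*-Solver
  +-+-swap : ∀ a b c d → a + b + (c + d) ≡ a + c + (b + d)
  +-+-swap = solve 4 (λ a b c d → a :+ b :+ (c :+ d) := a :+ c :+ (b :+ d)) refl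

sum-applyUpTo-at : ∀ r → sum (applyUpTo (at r) (suc (length r))) ≡ sum r
sum-applyUpTo-at r = begin
  sum (applyUpTo (at r) (suc (length r)))                  ≡⟨ cong sum (applyUpTo-∷ʳ (at r) (length r)) ⟨
  sum (applyUpTo (at r) (length r) ++ at r (length r) ∷ []) ≡⟨ sum-++ (applyUpTo (at r) (length r)) _ ⟩
  sum (applyUpTo (at r) (length r)) + (at r (length r) + 0) ≡⟨ cong₂ _+_ (cong sum (applyUpTo-at-length r))
                                                                          (cong (_+ 0) (at-≥length r ≤-refl)) ⟩
  sum r + 0                                                ≡⟨ +-identityʳ (sum r) ⟩
  sum r                                                    ∎
  where open ≡-Reasoning

sum-staircase : ∀ m s → sum (applyUpTo (λ i → suc i ∸ m) (m + s)) ≡ triangle s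
sum-staircase zero    s = sum-applyUpTo-suc s
  where
  sum-applyUpTo-suc : ∀ s → sum (applyUpTo suc s) ≡ triangle s
  sum-applyUpTo-suc zero    = refl
  sum-applyUpTo-suc (suc s) = begin
    sum (applyUpTo suc (suc s))                ≡⟨ cong sum (applyUpTo-∷ʳ suc s) ⟨
    sum (applyUpTo suc s ++ suc s ∷ [])        ≡⟨ sum-++ (applyUpTo suc s) _ ⟩
    sum (applyUpTo suc s) + (suc s + 0)        ≡⟨ cong₂ _+_ (sum-applyUpTo-suc s) (+-identityʳ (suc s)) ⟩
    triangle s + suc s                         ≡⟨ +-comm (triangle s) (suc s) ⟩
    triangle (suc s)                           ∎
    where open ≡-Reasoning
sum-staircase (suc m) s = trans (cong (_+ sum (applyUpTo (λ i → suc i ∸ m) (m + s))) (0∸n≡0 m)) (sum-staircase m s)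

raise : ℕ → List ℕ → ℕ → ℕ
raise m r i = at r i + (suc i ∸ m)

lower : ℕ → List ℕ → ℕ → ℕ
lower m λs i = at λs i ∸ (suc i ∸ m)

-- r padded by one 0 and raised by the staircase (i + 1) ∸ m: the rows of the partition above β.
top : ℕ → List ℕ → List ℕ
top m r = applyUpTo (raise m r) (suc (length r))

toPartition : ℕ → List ℕ → ℕ → List ℕ
toPartition m a k = top m (drop k a) ++ gapPartition k 0 (take k a)

toSUS : ℕ → List ℕ → ℕ → List ℕ
toSUS m λs j = ungap j 0 (drop (m + j) λs) ++ applyUpTo (lower m λs) (m + j ∸ 1)

sum-top : ∀ m {s r} → length r ≡ m + s → sum (top m r) ≡ sum r + triangle (suc s)
sum-top m {s} {r} ℓ≡ = trans (sum-applyUpTo-+ (at r) (λ i → suc i ∸ m) (suc (length r)))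
  (cong₂ _+_ (sum-applyUpTo-at r)
             (trans (cong (λ n → sum (applyUpTo (λ i → suc i ∸ m) n)) (trans (cong suc ℓ≡) (sym (+-suc m s))))
                    (sum-staircase m (suc s))))

module Stacked {m s : ℕ} {r β : List ℕ} (length-r : length r ≡ m + s) (decreasing : Chain _>_ r)
               (positive : All (1 ≤_) r) (parts : PartsAtMost (suc s) β) where

  λ′ : List ℕ
  λ′ = top m r ++ β

  length-top : length (top m r) ≡ suc (m + s)
  length-top = trans (length-applyUpTo (raise m r) (suc (length r))) (cong suc length-r)

  at-λ′ : ∀ {i} → i ≤ m + s → at λ′ i ≡ raise m r i
  at-λ′ {i} i≤ = trans (at-++ˡ (top m r) (subst (i <_) (sym length-top) (s≤s i≤)))
                       (at-applyUpTo (raise m r) (s≤s (subst (i ≤_) (sym length-r) i≤)))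

  raise-corner : raise m r (m + s) ≡ suc s
  raise-corner = cong₂ _+_ (at-≥length r (≤-reflexive length-r))
                           (trans (cong (_∸ m) (sym (+-suc m s))) (m+n∸m≡n m (suc s)))

  r-step : ∀ {i} → i < m + s → at r (suc i) < at r i
  r-step {i} i< with suc i <? m + s
  ... | yes si< = link decreasing i (subst (suc i <_) (sym length-r) si<)
  ... | no  si≮ = subst (_< at r i) (sym (at-≥length r (≤-trans (≤-reflexive length-r) (≮⇒≥ si≮))))
                        (at-All positive (subst (i <_) (sym length-r) i<))

  raise-antitone : ∀ {i} → i < m + s → raise m r (suc i) ≤ raise m r i
  raise-antitone {i} i< = begin
    at r (suc i) + (suc (suc i) ∸ m)   ≤⟨ +-monoʳ-≤ (at r (suc i)) (suc∸≤ (suc i) m) ⟩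
    at r (suc i) + suc (suc i ∸ m)     ≡⟨ +-suc (at r (suc i)) _ ⟩
    suc (at r (suc i)) + (suc i ∸ m)   ≤⟨ +-monoˡ-≤ _ (r-step i<) ⟩
    at r i + (suc i ∸ m)               ∎
    where open ≤-Reasoning

  raise-positive : ∀ {i} → i ≤ m + s → 1 ≤ raise m r i
  raise-positive {i} i≤ with m≤n⇒m<n∨m≡n i≤
  ... | inj₁ i< = ≤-trans (at-All positive (subst (i <_) (sym length-r) i<)) (m≤m+n _ _)
  ... | inj₂ refl = subst (1 ≤_) (sym raise-corner) (s≤s z≤n)

  β-chain : Chain _≥_ β × All (1 ≤_) β × at β 0 ≤ suc s
  β-chain = PartsAtMost⇒Chain parts

  λ′-decreasing : Chain _≥_ λ′
  λ′-decreasing = Chain-++ (top m r)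
    (Chain-applyUpTo (raise m r) (suc (length r))
      λ i si< → raise-antitone (≤-pred (subst (suc i <_) (cong suc length-r) si<)))
    (proj₁ β-chain)
    (λ _ _ → subst (at β 0 ≤_) (sym (trans (cong (at (top m r)) (cong pred length-top)) top-last))
                   (proj₂ (proj₂ β-chain)))
    where
    top-last : at (top m r) (m + s) ≡ suc s
    top-last = trans (at-applyUpTo (raise m r) (s≤s (≤-reflexive (sym length-r)))) raise-corner

  λ′-positive : All (1 ≤_) λ′
  λ′-positive = All.++⁺ (All.applyUpTo⁺₁ (raise m r) (suc (length r))
                          λ {i} i< → raise-positive (≤-pred (subst (i <_) (cong suc length-r) i<)))
                        (proj₁ (proj₂ β-chain))

  sum-λ′ : sum λ′ ≡ sum (ungap (suc s) 0 β) + sum r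
  sum-λ′ = begin
    sum (top m r ++ β)                          ≡⟨ sum-++ (top m r) β ⟩
    sum (top m r) + sum β                       ≡⟨ cong (_+ sum β) (sum-top m {s} {r} length-r) ⟩
    sum r + triangle (suc s) + sum β            ≡⟨ rearrange (sum r) (triangle (suc s)) (sum β) (suc s) ⟩
    (suc s * 0 + triangle (suc s) + sum β) + sum r ≡⟨ cong (_+ sum r) (sum-ungap (suc s) 0 parts) ⟨
    sum (ungap (suc s) 0 β) + sum r             ∎
    where
    open ≡-Reasoning
    open +-*-Solver
    rearrange : ∀ r t b s → r + t + b ≡ s * 0 + t + b + r
    rearrange = solve 4 (λ r t b s → r :+ t :+ b := s :* con 0 :+ t :+ b :+ r) refl

  length-λ′ : length λ′ ∸ suc (m + s) ≡ length β
  length-λ′ = trans (cong (_∸ suc (m + s)) (trans (length-++ (top m r)) (cong (_+ length β) length-top)))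
                    (m+n∸m≡n (suc (m + s)) (length β))

  lengths⇔peak : LengthCondition m (at λ′ 0 ∸ suc s) (length λ′ ∸ suc (m + s)) ⇔ at r 0 < suc s + length β
  lengths⇔peak rewrite length-λ′ =
    lengthCondition⇔ m (at-λ′ z≤n)
      (subst (_≤ at λ′ 0) (trans (at-λ′ ≤-refl) raise-corner) (at-antitone λ′-decreasing {0} {m + s} z≤n))

  λ′-UShape : at r 0 < suc s + length β → UShape m λ′ s
  λ′-UShape peak = record
    { rectangle = record
      { rows    = subst (suc (m + s) ≤_) (sym (trans (length-++ (top m r)) (cong (_+ length β) length-top))) (m≤m+n _ _)
      ; fits    = ≤-reflexive (sym corner≡)
      ; maximal = subst (_≤ suc s) (sym below-corner) (proj₂ (proj₂ β-chain)) }
    ; conditions = record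
      { corner    = ≤-reflexive corner≡
      ; topStrict = top-strict
      ; lengths   = from lengths⇔peak peak } }
    where
    corner≡ : at λ′ (m + s) ≡ suc s
    corner≡ = trans (at-λ′ ≤-refl) raise-corner
    below-corner : at λ′ (suc (m + s)) ≡ at β 0
    below-corner = trans (cong (at λ′) (sym (+-identityʳ (suc (m + s)))))
                         (subst (λ ℓ → at λ′ (ℓ + 0) ≡ at β 0) length-top (at-++ʳ (top m r) 0))
    flat : ∀ {i} → suc i ≤ m → i ≤ m + s → at λ′ i ≡ at r i
    flat {i} si≤m i≤ = trans (at-λ′ i≤) (trans (cong (at r i +_) (m≤n⇒m∸n≡0 si≤m)) (+-identityʳ _))
    top-strict : ∀ {v} → suc v < m → at λ′ (suc v) < at λ′ v
    top-strict {v} sv<m = subst₂ _<_ (sym (flat sv<m (≤-trans (<⇒≤ sv<m) (m≤m+n m s))))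
                                     (sym (flat (<⇒≤ sv<m) (≤-trans (<⇒≤ (<⇒≤ sv<m)) (m≤m+n m s))))
                                     (r-step (≤-trans (<⇒≤ sv<m) (m≤m+n m s)))

  toSUS-λ′ : toSUS m λ′ (suc s) ≡ ungap (suc s) 0 β ++ r
  toSUS-λ′ = cong₂ (λ β′ r′ → ungap (suc s) 0 β′ ++ r′)
    (drop-++-length (top m r) (trans length-top (sym (+-suc m s))))
    (begin
      applyUpTo (lower m λ′) (m + suc s ∸ 1) ≡⟨ cong (applyUpTo (lower m λ′)) (cong (_∸ 1) (+-suc m s)) ⟩
      applyUpTo (lower m λ′) (m + s)         ≡⟨ applyUpTo-cong (m + s) lower≡ ⟩
      applyUpTo (at r) (m + s)               ≡⟨ cong (applyUpTo (at r)) length-r ⟨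
      applyUpTo (at r) (length r)            ≡⟨ applyUpTo-at-length r ⟩
      r                                      ∎)
    where
    open ≡-Reasoning
    lower≡ : ∀ {i} → i < m + s → lower m λ′ i ≡ at r i
    lower≡ {i} i< = trans (cong (_∸ (suc i ∸ m)) (at-λ′ (<⇒≤ i<))) (m+n∸n≡m (at r i) (suc i ∸ m))

module FromPartition {m n s : ℕ} {λs : List ℕ} (dec : Chain _≥_ λs) (pos : All (1 ≤_) λs)
                     (weight : sum λs ≡ n) (shape : UShape m λs s) where

  open UShape shape

  r : List ℕ
  r = applyUpTo (lower m λs) (m + s)

  β : List ℕ
  β = drop (m + suc s) λs

  f : List ℕ
  f = ungap (suc s) 0 β

  length-r : length r ≡ m + s
  length-r = length-applyUpTo (lower m λs) (m + s)

  stairs<λ : ∀ {i} → i < m + s → suc i ∸ m < at λs i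
  stairs<λ {i} i< = ≤-trans (s≤s (m≤n+o⇒m∸n≤o (suc i) m i<))
                            (subst (_≤ at λs i) corner≡ (at-antitone dec (<⇒≤ i<)))

  r-positive : All (1 ≤_) r
  r-positive = All.applyUpTo⁺₁ (lower m λs) (m + s) λ i< → m<n⇒0<n∸m (stairs<λ i<)

  r-decreasing : Chain _>_ r
  r-decreasing = Chain-applyUpTo (lower m λs) (m + s) step
    where
    step : ∀ i → suc i < m + s → lower m λs (suc i) < lower m λs i
    step i si< with suc i <? m
    ... | yes si<m = subst₂ _<_ (cong (at λs (suc i) ∸_) (sym (m≤n⇒m∸n≡0 si<m)))
                                (cong (at λs i ∸_) (sym (m≤n⇒m∸n≡0 (<⇒≤ si<m)))) (topStrict si<m)
    ... | no  si≮m = begin-strict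
      at λs (suc i) ∸ (suc (suc i) ∸ m)   ≡⟨ cong (at λs (suc i) ∸_) stairs-suc ⟩
      at λs (suc i) ∸ suc (suc i ∸ m)     <⟨ ∸-monoʳ-< (n<1+n _) (<⇒≤ (subst (_< at λs (suc i)) stairs-suc
                                                                                (stairs<λ si<))) ⟩
      at λs (suc i) ∸ (suc i ∸ m)         ≤⟨ ∸-monoˡ-≤ (suc i ∸ m) (at-antitone dec (n≤1+n i)) ⟩
      at λs i ∸ (suc i ∸ m)               ∎
      where
      open ≤-Reasoning
      stairs-suc : suc (suc i) ∸ m ≡ suc (suc i ∸ m)
      stairs-suc = +-∸-assoc 1 (≮⇒≥ si≮m)

  β-parts : PartsAtMost (suc s) β
  β-parts = Chain⇒PartsAtMost β (Chain-drop (m + suc s) λs dec) (All.drop⁺ (m + suc s) pos)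
    (subst (_≤ suc s) (sym (trans (at-drop (m + suc s) λs 0) (cong (at λs) (trans (+-identityʳ _) (+-suc m s))))) maximal)

  open Stacked {m} length-r r-decreasing r-positive β-parts

  λ′≡λs : λ′ ≡ λs
  λ′≡λs = begin
    top m r ++ β                                         ≡⟨ cong (_++ β) top≡ ⟩
    take (suc (m + s)) λs ++ drop (m + suc s) λs         ≡⟨ cong (λ k → take (suc (m + s)) λs ++ drop k λs) (+-suc m s) ⟩
    take (suc (m + s)) λs ++ drop (suc (m + s)) λs       ≡⟨ take++drop≡id (suc (m + s)) λs ⟩
    λs                                                   ∎
    where
    open ≡-Reasoning
    raise≡ : ∀ {i} → i < suc (m + s) → raise m r i ≡ at λs i
    raise≡ {i} i≤ with m≤n⇒m<n∨m≡n (≤-pred i≤)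
    ... | inj₁ i< = trans (cong (_+ (suc i ∸ m)) (at-applyUpTo (lower m λs) i<)) (m∸n+n≡m (<⇒≤ (stairs<λ i<)))
    ... | inj₂ refl = trans raise-corner (sym corner≡)
    top≡ : top m r ≡ take (suc (m + s)) λs
    top≡ = trans (cong (λ ℓ → applyUpTo (raise m r) (suc ℓ)) length-r)
                 (trans (applyUpTo-cong (suc (m + s)) raise≡) (applyUpTo-at λs rows))

  unimodal : UnimodalShape m n s f r
  unimodal = record
    { length-f   = length-ungap (suc s) 0 β
    ; length-r   = length-r
    ; increasing = ungap-increasing (suc s) 0 β
    ; decreasing = r-decreasing
    ; positive   = r-positive
    ; peak       = subst (at r 0 <_) (sym (last-ungap s 0 β-parts)) (to lengths⇔peak lengths′)
    ; weight     = trans (sym sum-λ′) (trans (cong sum λ′≡λs) weight) }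
    where
    lengths′ : LengthCondition m (at λ′ 0 ∸ suc s) (length λ′ ∸ suc (m + s))
    lengths′ = subst (λ μ → LengthCondition m (at μ 0 ∸ suc s) (length μ ∸ suc (m + s))) (sym λ′≡λs) lengths

  toSUS≡ : toSUS m λs (suc s) ≡ f ++ r
  toSUS≡ = cong (λ ℓ → f ++ applyUpTo (lower m λs) ℓ) (cong (_∸ 1) (+-suc m s))

  toPartition-toSUS : toPartition m (f ++ r) (suc s) ≡ λs
  toPartition-toSUS = begin
    top m (drop (suc s) (f ++ r)) ++ gapPartition (suc s) 0 (take (suc s) (f ++ r))
      ≡⟨ cong₂ (λ r′ f′ → top m r′ ++ gapPartition (suc s) 0 f′) (drop-++-length f ℓf) (take-++-length f ℓf) ⟩
    top m r ++ gapPartition (suc s) 0 f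
      ≡⟨ cong (top m r ++_) (gapPartition-ungap (suc s) 0 β-parts) ⟩
    λ′
      ≡⟨ λ′≡λs ⟩
    λs ∎
    where
    open ≡-Reasoning
    ℓf : length f ≡ suc s
    ℓf = length-ungap (suc s) 0 β

module FromSUS {m n s : ℕ} {f r : List ℕ} (shape : UnimodalShape m n s f r) where

  open UnimodalShape shape

  β : List ℕ
  β = gapPartition (suc s) 0 f

  β-parts : PartsAtMost (suc s) β
  β-parts = gapPartition-PartsAtMost (suc s) length-f increasing

  ungap-β : ungap (suc s) 0 β ≡ f
  ungap-β = ungap-gapPartition (suc s) length-f increasing

  open Stacked {m} length-r decreasing positive β-parts public

  λ′-partition : T (isPartitionOf n λ′)
  λ′-partition = from (T-weaklyDecreasing λ′ ⟨∧⟩ T-allPositive λ′ ⟨∧⟩ T-≡ᵇ (sum λ′) n)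
    (λ′-decreasing , λ′-positive , trans sum-λ′ (trans (cong (λ f′ → sum f′ + sum r) ungap-β) weight))

  λ′-shape : UShape m λ′ s
  λ′-shape = λ′-UShape (subst (at r 0 <_) f-last peak)
    where
    f-last : at f s ≡ suc s + length β
    f-last = trans (cong (λ f′ → at f′ s) (sym ungap-β)) (last-ungap s 0 β-parts)

  λ′-inU : durfeeJ m λ′ ≡ suc s × T (inU m λ′)
  λ′-inU = UShape⇒inU λ′-decreasing λ′-shape

  toSUS-toPartition : toSUS m λ′ (suc s) ≡ f ++ r
  toSUS-toPartition = trans toSUS-λ′ (cong (_++ r) ungap-β)

module _ {m n : ℕ} where

  IsPartitionOf : List ℕ → Set
  IsPartitionOf λs = Chain _≥_ λs × All (1 ≤_) λs × sum λs ≡ n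

  T-U : ∀ λs → T (isPartitionOf n λs ∧ inU m λs) ⇔ (IsPartitionOf λs × T (inU m λs))
  T-U λs = (T-weaklyDecreasing λs ⟨∧⟩ T-allPositive λs ⟨∧⟩ T-≡ᵇ (sum λs) n) ⟨∧⟩ mk⇔ id id

  toSUS-∈SUS : ∀ {λs} → IsPartitionOf λs × T (inU m λs) → T (isSUSRank m n (toSUS m λs (durfeeJ m λs)) (durfeeJ m λs))
  toSUS-∈SUS {λs} ((dec , pos , wt) , u) with inU⇒UShape dec pos u
  ... | s , j≡ , shape = subst (λ j → T (isSUSRank m n (toSUS m λs j) j)) (sym j≡)
    (subst (λ a → T (isSUSRank m n a (suc s))) (sym toSUS≡) (UnimodalShape⇒isSUSRank unimodal))
    where open FromPartition dec pos wt shape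

  toPartition-toSUS-≡ : ∀ {λs} → IsPartitionOf λs × T (inU m λs) →
                        toPartition m (toSUS m λs (durfeeJ m λs)) (durfeeJ m λs) ≡ λs
  toPartition-toSUS-≡ {λs} ((dec , pos , wt) , u) with inU⇒UShape dec pos u
  ... | s , j≡ , shape = begin
    toPartition m (toSUS m λs (durfeeJ m λs)) (durfeeJ m λs) ≡⟨ cong (λ j → toPartition m (toSUS m λs j) j) j≡ ⟩
    toPartition m (toSUS m λs (suc s)) (suc s)               ≡⟨ cong (λ a → toPartition m a (suc s)) toSUS≡ ⟩
    toPartition m (f ++ r) (suc s)                           ≡⟨ toPartition-toSUS ⟩
    λs                                                       ∎
    where
    open ≡-Reasoning
    open FromPartition dec pos wt shape

  toPartition-∈U : ∀ {a k} → T (isSUSRank m n a k) → T (isPartitionOf n (toPartition m a k) ∧ inU m (toPartition m a k))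
  toPartition-∈U {a} {k} t with isSUSRank⇒UnimodalShape {m} {n} {a} {k} t
  ... | s , refl , shape = from T-∧ (λ′-partition , proj₂ λ′-inU)
    where open FromSUS shape

  toSUS-toPartition-≡ : ∀ {a k} → T (isSUSRank m n a k) →
                        let λ′ = toPartition m a k in toSUS m λ′ (durfeeJ m λ′) ≡ a × durfeeJ m λ′ ≡ k
  toSUS-toPartition-≡ {a} {k} t with isSUSRank⇒UnimodalShape {m} {n} {a} {k} t
  ... | s , refl , shape = (begin
    toSUS m λ′ (durfeeJ m λ′)           ≡⟨ cong (toSUS m λ′) (proj₁ λ′-inU) ⟩
    toSUS m λ′ (suc s)                  ≡⟨ toSUS-toPartition ⟩
    take (suc s) a ++ drop (suc s) a    ≡⟨ take++drop≡id (suc s) a ⟩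
    a                                   ∎) , proj₁ λ′-inU
    where
    open ≡-Reasoning
    open FromSUS shape

  toU : SUS m n → U m n
  toU (a , k , t) = toPartition m a k , toPartition-∈U {a} {k} t

  fromU : U m n → SUS m n
  fromU (λs , t) = toSUS m λs (durfeeJ m λs) , durfeeJ m λs , toSUS-∈SUS {λs} (to (T-U λs) t)

  U-≡ : ∀ {λs λs′} {t : T (isPartitionOf n λs ∧ inU m λs)} {t′ : T (isPartitionOf n λs′ ∧ inU m λs′)} →
        λs ≡ λs′ → _≡_ {A = U m n} (λs , t) (λs′ , t′)
  U-≡ {t = t} {t′} refl = cong (_ ,_) (T-irrelevant t t′)

  SUS-≡ : ∀ {a a′ k k′} {t : T (isSUSRank m n a k)} {t′ : T (isSUSRank m n a′ k′)} →
          a ≡ a′ × k ≡ k′ → _≡_ {A = SUS m n} (a , k , t) (a′ , k′ , t′)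
  SUS-≡ {t = t} {t′} (refl , refl) = cong (λ t″ → _ , _ , t″) (T-irrelevant t t′)

  toU∘fromU : ∀ x → toU (fromU x) ≡ x
  toU∘fromU (λs , t) = U-≡ (toPartition-toSUS-≡ (to (T-U λs) t))

  fromU∘toU : ∀ y → fromU (toU y) ≡ y
  fromU∘toU (a , k , t) = SUS-≡ (toSUS-toPartition-≡ {a} {k} t)

theorem2p4 : (m n : ℕ) → U m n ↔ SUS m n
theorem2p4 m n = mk↔ₛ′ fromU toU fromU∘toU toU∘fromU
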